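{- Let $G$ be a graph on $\omega$. The set $H_G$ of simple automorphisms of $G$ is a closed subgroup of $S_\infty$.
   Context: $S_\infty$ is the Polish group of permutations of $\omega$. An automorphism $\varphi$ of a graph $G$ is simple if whenever $\varphi(u)\ne u$, the vertex $u$ belongs to a unique maximal clique of $G$ and $\varphi(u)$ belongs to this same clique. -}

module Defs where

open import Level using (0ℓ)
open import Data.Nat using (ℕ; _<_)
open import Data.Product using (Σ; _×_; ∃)
open import Data.Empty using (⊥)
open import Relation.Nullary using (¬_)
open import Relation.Unary using (Pred; _∈_; _⊆_)
open import Relation.Binary.PropositionalEquality using (_≡_; _≢_)
open import Function using (_∘_; id)
open import Function.Bundles using (_↔_; Inverse; _⇔_)
open import Function.Construct.Identity using (↔-id)
open import Function.Construct.Composition using (_↔-∘_)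
open import Function.Construct.Symmetry using (↔-sym)

record Graph : Set₁ where
  field
    E     : ℕ → ℕ → Set
    sym   : ∀ {x y} → E x y → E y x
    irrefl : ∀ {x} → ¬ E x x
open Graph public

S∞ : Set
S∞ = ℕ ↔ ℕ

app : S∞ → ℕ → ℕ
app φ = Inverse.to φ

-- Group operations of S∞ (composition convention: (φ · ψ) x = φ (ψ x)).
idS : S∞
idS = ↔-id ℕ

_·_ : S∞ → S∞ → S∞
φ · ψ = ψ ↔-∘ φ

inv : S∞ → S∞
inv φ = ↔-sym φ

IsAut : Graph → S∞ → Set
IsAut G φ = ∀ x y → E G x y ⇔ E G (app φ x) (app φ y)

IsClique : Graph → Pred ℕ 0ℓ → Set
IsClique G C = ∀ {x y} → x ∈ C → y ∈ C → x ≢ y → E G x y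

IsMaxClique : Graph → Pred ℕ 0ℓ → Set₁
IsMaxClique G C = IsClique G C × (∀ (D : Pred ℕ 0ℓ) → IsClique G D → C ⊆ D → D ⊆ C)

_≐_ : Pred ℕ 0ℓ → Pred ℕ 0ℓ → Set
C ≐ D = (C ⊆ D) × (D ⊆ C)

UniqueMaxCliqueWith : Graph → ℕ → ℕ → Set₁
UniqueMaxCliqueWith G u v =
  Σ (Pred ℕ 0ℓ) λ C → IsMaxClique G C × u ∈ C × v ∈ C ×
    (∀ (D : Pred ℕ 0ℓ) → IsMaxClique G D → u ∈ D → C ≐ D)

IsSimpleAut : Graph → S∞ → Set₁
IsSimpleAut G φ = IsAut G φ ×
  (∀ u → app φ u ≢ u → UniqueMaxCliqueWith G u (app φ u))

IsSubgroup : (S∞ → Set₁) → Set₁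
IsSubgroup H = H idS × (∀ φ ψ → H φ → H ψ → H (φ · ψ)) × (∀ φ → H φ → H (inv φ))

-- Closed subsets of S∞ (topology of pointwise convergence): every φ all of whose
-- basic neighbourhoods {ψ | ψ i = φ i for i < n} meet H lies in H.
IsClosed : (S∞ → Set₁) → Set₁
IsClosed H = ∀ φ → (∀ n → Σ S∞ λ ψ → H ψ × (∀ i → i < n → app ψ i ≡ app φ i)) → H φ

module Submission where

-- The heart of the argument is one observation: a simple automorphism φ maps
-- every maximal clique C into itself.  (A vertex w ∈ C moved by φ lies in a
-- unique maximal clique, which must then be C, and φ w lies in it.)  Since the
-- preimage of a clique under an automorphism is again a clique, maximality of C
-- upgrades this to φ⁻¹[C] = C: simple automorphisms fix every maximal clique
-- setwise.
--
-- Closedness in the pointwise topology holds because both conditions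
-- defining a simple automorphism only look at finitely many values at a time.

open import Defs hiding (sym)
open import Data.Product using (_×_; _,_; proj₁; proj₂)
open import Level using (0ℓ)
open import Data.Nat using (ℕ; _≟_; suc; _⊔_; s≤s)
open import Data.Nat.Properties using (m≤m⊔n; m≤n⊔m; ≤-refl)
open import Data.Empty using (⊥-elim)
open import Relation.Nullary using (yes; no)
open import Relation.Unary using (Pred; _∈_; _⊆_)
open import Relation.Binary.PropositionalEquality
  using (_≡_; _≢_; refl; sym; trans; cong; subst; subst₂)
open import Function.Bundles using (Inverse; Equivalence; mk⇔; _⇔_)
open import Function.Construct.Identity using (⇔-id)
open import Function.Construct.Composition using (_⇔-∘_)

unapp : S∞ → ℕ → ℕ
unapp φ = Inverse.from φ

app-unapp : (φ : S∞) → ∀ x → app φ (unapp φ x) ≡ x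
app-unapp φ = Inverse.strictlyInverseˡ φ

unapp-app : (φ : S∞) → ∀ x → unapp φ (app φ x) ≡ x
unapp-app φ = Inverse.strictlyInverseʳ φ

app-injective : (φ : S∞) → ∀ {x y} → app φ x ≡ app φ y → x ≡ y
app-injective φ {x} {y} eq =
  trans (sym (unapp-app φ x)) (trans (cong (unapp φ) eq) (unapp-app φ y))

Pre : S∞ → Pred ℕ 0ℓ → Pred ℕ 0ℓ
Pre φ C x = C (app φ x)

≐-trans : ∀ {C D F : Pred ℕ 0ℓ} → C ≐ D → D ≐ F → C ≐ F
≐-trans (C⊆D , D⊆C) (D⊆F , F⊆D) = (λ x∈C → D⊆F (C⊆D x∈C)) , (λ x∈F → D⊆C (F⊆D x∈F))

module _ (G : Graph) where

  aut-id : IsAut G idS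
  aut-id x y = ⇔-id _

  aut-· : ∀ φ ψ → IsAut G φ → IsAut G ψ → IsAut G (φ · ψ)
  aut-· φ ψ Aφ Aψ x y = Aψ (app φ x) (app φ y) ⇔-∘ Aφ x y

  aut-inv : ∀ φ → IsAut G φ → IsAut G (inv φ)
  aut-inv φ A x y = mk⇔
    (λ e → Equivalence.from (A (unapp φ x) (unapp φ y))
             (subst₂ (E G) (sym (app-unapp φ x)) (sym (app-unapp φ y)) e))
    (λ e → subst₂ (E G) (app-unapp φ x) (app-unapp φ y)
             (Equivalence.to (A (unapp φ x) (unapp φ y)) e))

  pre-clique : ∀ φ → IsAut G φ → ∀ C → IsClique G C → IsClique G (Pre φ C)
  pre-clique φ A C clique {x} {y} x∈ y∈ x≢y =
    Equivalence.from (A x y) (clique x∈ y∈ λ eq → x≢y (app-injective φ eq))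

  simple-maps-into : ∀ φ → IsSimpleAut G φ → ∀ C → IsMaxClique G C → C ⊆ Pre φ C
  simple-maps-into φ (_ , simple) C maxC {w} w∈C with app φ w ≟ w
  ... | yes fixed = subst C (sym fixed) w∈C
  ... | no moved with simple w moved
  ... | Cw , _ , _ , φw∈Cw , unique = proj₁ (unique C maxC w∈C) φw∈Cw

  simple-fixes : ∀ φ → IsSimpleAut G φ → ∀ C → IsMaxClique G C → Pre φ C ≐ C
  simple-fixes φ S@(A , _) C maxC@(cliqueC , maximal) =
    maximal (Pre φ C) (pre-clique φ A C cliqueC) C⊆Pre , C⊆Pre
    where
    C⊆Pre : C ⊆ Pre φ C
    C⊆Pre = simple-maps-into φ S C maxC

  unique-clique-image : ∀ φ → IsSimpleAut G φ → ∀ {u v} →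
    UniqueMaxCliqueWith G u v → UniqueMaxCliqueWith G u (app φ v)
  unique-clique-image φ S (C , maxC , u∈C , v∈C , unique) =
    C , maxC , u∈C , proj₂ (simple-fixes φ S C maxC) v∈C , unique

  unique-clique-swap : ∀ {u v} → (∀ D → IsMaxClique G D → u ∈ D → v ∈ D) →
    UniqueMaxCliqueWith G v u → UniqueMaxCliqueWith G u v
  unique-clique-swap u⇒v (C , maxC , v∈C , u∈C , unique) =
    C , maxC , u∈C , v∈C , λ D maxD u∈D → unique D maxD (u⇒v D maxD u∈D)

  simple-id : IsSimpleAut G idS
  simple-id = aut-id , λ u moved → ⊥-elim (moved refl)

  -- A vertex moved by φ · ψ is moved by φ (then use φ and push forward by ψ),
  -- or fixed by φ and moved by ψ.
  simple-· : ∀ φ ψ → IsSimpleAut G φ → IsSimpleAut G ψ → IsSimpleAut G (φ · ψ)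
  simple-· φ ψ Sφ@(Aφ , simpleφ) Sψ@(Aψ , simpleψ) = aut-· φ ψ Aφ Aψ , simple
    where
    simple : ∀ u → app (φ · ψ) u ≢ u → UniqueMaxCliqueWith G u (app (φ · ψ) u)
    simple u moved with app φ u ≟ u
    ... | yes fixed = subst (λ x → UniqueMaxCliqueWith G u (app ψ x)) (sym fixed)
                        (simpleψ u (subst (λ x → app ψ x ≢ u) fixed moved))
    ... | no movedφ = unique-clique-image ψ Sψ (simpleφ u movedφ)

  -- With v = φ⁻¹ u we have φ v = u ≠ v; the clique data for v transfers to u
  -- because maximal cliques through u = φ v pass through v.
  simple-inv : ∀ φ → IsSimpleAut G φ → IsSimpleAut G (inv φ)
  simple-inv φ S@(A , simpleφ) = aut-inv φ A , simple
    where
    simple : ∀ u → app (inv φ) u ≢ u → UniqueMaxCliqueWith G u (app (inv φ) u)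
    simple u moved = unique-clique-swap u⇒v
      (subst (UniqueMaxCliqueWith G v) (app-unapp φ u)
        (simpleφ v λ eq → moved (trans (sym eq) (app-unapp φ u))))
      where
      v : ℕ
      v = unapp φ u
      u⇒v : ∀ D → IsMaxClique G D → u ∈ D → v ∈ D
      u⇒v D maxD u∈D = proj₁ (simple-fixes φ S D maxD) (subst D (sym (app-unapp φ u)) u∈D)

  -- Both conditions defining simple automorphisms depend on finitely many
  -- values only, so a limit of simple automorphisms is simple.
  simple-closed : IsClosed (IsSimpleAut G)
  simple-closed φ approx = aut , simple
    where
    aut : IsAut G φ
    aut x y with approx (suc (x ⊔ y))
    ... | ψ , (Aψ , _) , agree =
      subst₂ (λ a b → E G x y ⇔ E G a b)
        (agree x (s≤s (m≤m⊔n x y))) (agree y (s≤s (m≤n⊔m x y))) (Aψ x y)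
    simple : ∀ u → app φ u ≢ u → UniqueMaxCliqueWith G u (app φ u)
    simple u moved with approx (suc u)
    ... | ψ , (_ , simpleψ) , agree =
      subst (UniqueMaxCliqueWith G u) agreeᵤ
        (simpleψ u λ eq → moved (trans (sym agreeᵤ) eq))
      where
      agreeᵤ : app ψ u ≡ app φ u
      agreeᵤ = agree u (s≤s ≤-refl)

lemma5p4 : (G : Graph) → IsSubgroup (IsSimpleAut G) × IsClosed (IsSimpleAut G)
lemma5p4 G = (simple-id G , simple-· G , simple-inv G) , simple-closed G
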